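{- Let $n\ge1$ and let $D$ be a Dyck path of size $n$ with area partition $\mu(D)=(\mu_1,\dots,\mu_n)$. Let $G(D)$ be the subgraph of the complete graph $K_{n+1}$ on $[n+1]$ with edge set $\{\{i,\,n+1-t\}: 1\le i\le n,\ 0\le t<\mu_i\}$. Then $G(D)$ is slim, i.e. $K_{n+1}-G(D)$ is a connected graph on the vertex set $[n+1]$.
   Context: A Dyck path of size $n$ is a lattice path from $(0,0)$ to $(n,n)$ with unit steps $(0,1)$ and $(1,0)$ staying weakly above $y=x$. Its area partition $\mu(D)$ is the partition with $n$ parts (zeros allowed) whose Ferrers diagram (English notation, in the upper left corner of the $n\times n$ square $[0,n]^2$) is the set of unit boxes to the upper left of $D$. (Equivalently, $G(D)$ consists of the edges $e(b)$ for boxes $b$ to the upper left of $D$, where a box in the $i$-th row from the top and $(t+1)$-st column from the left is labeled with the edge $\{i,n+1-t\}$.) -}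

module Defs where

open import Data.Nat using (ℕ; zero; suc; _+_; _∸_; _≤_; _<_)
open import Data.Fin using (Fin; toℕ)
open import Data.List using (List; []; _∷_; take)
open import Data.Product using (Σ; _×_; ∃)
open import Data.Sum using (_⊎_)
open import Relation.Nullary using (¬_)
open import Relation.Binary.PropositionalEquality using (_≡_; _≢_)
open import Relation.Binary.Construct.Closure.ReflexiveTransitive using (Star)

-- Unit steps of a lattice path: N = (0,1), E = (1,0).
data Step : Set where
  N E : Step

countN : List Step → ℕ
countN []       = 0
countN (N ∷ s)  = suc (countN s)
countN (E ∷ s)  = countN s

countE : List Step → ℕ
countE []       = 0
countE (N ∷ s)  = countE s
countE (E ∷ s)  = suc (countE s)

record DyckPath (n : ℕ) : Set where
  field
    steps : List Step
    numN  : countN steps ≡ n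
    numE  : countE steps ≡ n
    above : ∀ k → countE (take k steps) ≤ countN (take k steps)
open DyckPath public

-- xAtNorth x s j : the x-coordinate of the north step of s going from
-- height j to height j+1, when s starts at x-coordinate x (and height 0).
xAtNorth : ℕ → List Step → ℕ → ℕ
xAtNorth x []      j       = 0
xAtNorth x (E ∷ s) j       = xAtNorth (suc x) s j
xAtNorth x (N ∷ s) zero    = x
xAtNorth x (N ∷ s) (suc j) = xAtNorth x s j

-- Area partition μ(D) = (μ_1,…,μ_n): μ_i is the number of unit boxes in the
-- i-th row from the top (the row between heights n-i and n-i+1) lying to the
-- upper left of D, i.e. the x-coordinate of D's north step in that row.
-- Row index r : Fin n corresponds to i = r + 1.
areaPart : ∀ {n} → DyckPath n → Fin n → ℕ
areaPart {n} D r = xAtNorth 0 (steps D) (n ∸ suc (toℕ r))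

EdgeG : ∀ {n} → DyckPath n → ℕ → ℕ → Set
EdgeG {n} D a b =
  Σ (Fin n) λ r → Σ ℕ λ t → t < areaPart D r ×
    ((a ≡ suc (toℕ r) × b ≡ suc n ∸ t) ⊎ (a ≡ suc n ∸ t × b ≡ suc (toℕ r)))

-- Adjacency in K_{n+1} - G(D), vertices Fin (n+1) with vertex u labelled toℕ u + 1.
ComplAdj : ∀ {n} → DyckPath n → Fin (suc n) → Fin (suc n) → Set
ComplAdj D u v = u ≢ v × ¬ EdgeG D (suc (toℕ u)) (suc (toℕ v))

Connected : ∀ {n} → (Fin n → Fin n → Set) → Set
Connected {n} adj = ∀ (u v : Fin n) → Star adj u v

Slim : ∀ {n} → DyckPath n → Set
Slim D = Connected (ComplAdj D)

module Submission where

open import Defs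
open import Data.Nat using (ℕ; zero; suc; _+_; _∸_; _≤_; _<_; z≤n; s≤s)
open import Data.Nat.Properties
open import Data.Fin using (Fin; toℕ; inject₁) renaming (zero to fzero; suc to fsuc)
open import Data.Fin.Properties using (toℕ<n; toℕ-inject₁)
open import Data.Fin.Induction using (<-weakInduction)
open import Data.List using (List; []; _∷_; take)
open import Data.Product using (_,_)
open import Data.Sum using (_⊎_; inj₁; inj₂)
open import Relation.Nullary using (¬_)
open import Relation.Binary.PropositionalEquality
open import Relation.Binary.Construct.Closure.ReflexiveTransitive using (Star; ε; _◅_; _◅◅_)

-- An edge {i, n+1-t} of G(D) has t < μ_i ≤ n - i, so its endpoints differ by at least 2;
-- hence every pair {i, i+1} is an edge of the complement, whose path 1 - 2 - ⋯ - (n+1)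
-- already connects all vertices.

-- Read with x and h as offsets: a path starting at abscissa x whose prefixes never
-- fall below the diagonal shifted up by h crosses height j at abscissa at most h + j.
xAtNorth≤ : ∀ (s : List Step) x h j →
            (∀ k → x + countE (take k s) ≤ h + countN (take k s)) →
            xAtNorth x s j ≤ h + j
xAtNorth≤ []      x h j       prefix≤ = z≤n
xAtNorth≤ (E ∷ s) x h j       prefix≤ =
  xAtNorth≤ s (suc x) h j λ k → subst (_≤ h + countN (take k s)) (+-suc x _) (prefix≤ (suc k))
xAtNorth≤ (N ∷ s) x h zero    prefix≤ = subst (_≤ h + 0) (+-identityʳ x) (prefix≤ 0)
xAtNorth≤ (N ∷ s) x h (suc j) prefix≤ =
  subst (xAtNorth x s j ≤_) (sym (+-suc h j))
    (xAtNorth≤ s x (suc h) j λ k → subst (x + countE (take k s) ≤_) (+-suc h _) (prefix≤ (suc k)))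

areaPart+row≤size : ∀ {n} (D : DyckPath n) (r : Fin n) → areaPart D r + suc (toℕ r) ≤ n
areaPart+row≤size {n} D r =
  m≤o∸n⇒m+n≤o (areaPart D r) (toℕ<n r) (xAtNorth≤ (steps D) 0 0 (n ∸ suc (toℕ r)) (above D))

row-column-gap : ∀ {n} (D : DyckPath n) (r : Fin n) {t} → t < areaPart D r →
                 suc (suc (toℕ r)) < suc n ∸ t
row-column-gap {n} D r {t} t<μ = m+n≤o⇒m≤o∸n (suc (suc (suc i))) (begin
  suc (suc (suc i)) + t      ≡⟨ cong (λ m → suc (suc m)) (+-comm (suc i) t) ⟩
  suc (suc (t + suc i))      ≤⟨ s≤s (+-monoˡ-≤ (suc i) t<μ) ⟩
  suc (areaPart D r + suc i) ≤⟨ s≤s (areaPart+row≤size D r) ⟩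
  suc n                      ∎)
  where
  open ≤-Reasoning
  i : ℕ
  i = toℕ r

edge-gap : ∀ {n} (D : DyckPath n) {a b} → EdgeG D a b → suc a < b ⊎ suc b < a
edge-gap D (r , t , t<μ , inj₁ (refl , refl)) = inj₁ (row-column-gap D r t<μ)
edge-gap D (r , t , t<μ , inj₂ (refl , refl)) = inj₂ (row-column-gap D r t<μ)

¬EdgeG-suc : ∀ {n} (D : DyckPath n) a → ¬ EdgeG D a (suc a)
¬EdgeG-suc D a e with edge-gap D e
... | inj₁ 1+a<1+a = <-irrefl refl 1+a<1+a
... | inj₂ 2+a<a   = <-asym (<-trans (n<1+n a) (n<1+n (suc a))) 2+a<a

¬EdgeG-pred : ∀ {n} (D : DyckPath n) a → ¬ EdgeG D (suc a) a
¬EdgeG-pred D a e with edge-gap D e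
... | inj₁ 2+a<a   = <-asym (<-trans (n<1+n a) (n<1+n (suc a))) 2+a<a
... | inj₂ 1+a<1+a = <-irrefl refl 1+a<1+a

inject₁≢suc : ∀ {n} (k : Fin n) → inject₁ k ≢ fsuc k
inject₁≢suc k eq = <-irrefl (trans (sym (toℕ-inject₁ k)) (cong toℕ eq)) (n<1+n (toℕ k))

ComplAdj-inject₁-suc : ∀ {n} (D : DyckPath n) (k : Fin n) → ComplAdj D (inject₁ k) (fsuc k)
ComplAdj-inject₁-suc D k rewrite toℕ-inject₁ k =
  inject₁≢suc k , ¬EdgeG-suc D (suc (toℕ k))

ComplAdj-suc-inject₁ : ∀ {n} (D : DyckPath n) (k : Fin n) → ComplAdj D (fsuc k) (inject₁ k)
ComplAdj-suc-inject₁ D k rewrite toℕ-inject₁ k =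
  (λ eq → inject₁≢suc k (sym eq)) , ¬EdgeG-pred D (suc (toℕ k))

connected-if-consecutive : ∀ {n} (R : Fin (suc n) → Fin (suc n) → Set) →
                           (∀ k → R (inject₁ k) (fsuc k)) → (∀ k → R (fsuc k) (inject₁ k)) →
                           Connected R
connected-if-consecutive R up down u v = toZero u ◅◅ fromZero v
  where
  fromZero : ∀ v → Star R fzero v
  fromZero = <-weakInduction (Star R fzero) ε (λ k path → path ◅◅ up k ◅ ε)
  toZero : ∀ u → Star R u fzero
  toZero = <-weakInduction (λ u → Star R u fzero) ε (λ k path → down k ◅ path)

lemma1 : (n : ℕ) → 1 ≤ n → (D : DyckPath n) → Slim D
lemma1 n _ D =
  connected-if-consecutive (ComplAdj D) (ComplAdj-inject₁-suc D) (ComplAdj-suc-inject₁ D)
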